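{- Every $5\times4$ nowhere zero sign pattern $S$ is sign equivalent to a sign pattern with at most $5$ negative entries.
   Context: A sign pattern is an array with entries in $\{+,-,0\}$; it is nowhere zero if it has no $0$ entries. For a sign pattern $S$, $C_S$ is the unique $(1,-1,0)$-matrix with sign pattern $S$. A signed permutation matrix is a square $(1,-1,0)$-matrix with exactly one nonzero entry in each row and column. Sign patterns $S,S'$ are sign equivalent if $C_S=P_1C_{S'}P_2$ for some signed permutation matrices $P_1,P_2$. -}

module Defs where

open import Data.Nat using (ℕ; _≤_)
open import Data.Integer using (ℤ; +_; -[1+_]; 0ℤ; 1ℤ; -1ℤ; _*_; _+_)
open import Data.Fin using (Fin)
open import Data.Vec.Functional using (Vector; foldr)
open import Data.Product using (Σ; ∃; _×_; _,_)
open import Data.Sum using (_⊎_)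
open import Data.Nat using (suc)
open import Relation.Binary.PropositionalEquality using (_≡_; _≢_)

data Sign : Set where
  plus minus zer : Sign

SignPattern : ℕ → ℕ → Set
SignPattern m n = Fin m → Fin n → Sign

Matrix : ℕ → ℕ → Set
Matrix m n = Fin m → Fin n → ℤ

NowhereZero : ∀ {m n} → SignPattern m n → Set
NowhereZero {m} {n} S = ∀ (i : Fin m) (j : Fin n) → S i j ≢ zer

signVal : Sign → ℤ
signVal plus  = 1ℤ
signVal minus = -1ℤ
signVal zer   = 0ℤ

C : ∀ {m n} → SignPattern m n → Matrix m n
C S i j = signVal (S i j)

Σ[<] : ∀ {n} → (Fin n → ℤ) → ℤ
Σ[<] f = foldr _+_ 0ℤ f

_⊗_ : ∀ {m n p} → Matrix m n → Matrix n p → Matrix m p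
(A ⊗ B) i k = Σ[<] (λ j → A i j * B j k)

IsSignEntry : ℤ → Set
IsSignEntry x = (x ≡ 1ℤ ⊎ x ≡ -1ℤ) ⊎ x ≡ 0ℤ

IsSignedPerm : ∀ {n} → Matrix n n → Set
IsSignedPerm {n} P =
  (∀ i j → IsSignEntry (P i j)) ×
  (∀ i → Σ (Fin n) λ j → P i j ≢ 0ℤ × (∀ k → P i k ≢ 0ℤ → k ≡ j)) ×
  (∀ j → Σ (Fin n) λ i → P i j ≢ 0ℤ × (∀ k → P k j ≢ 0ℤ → k ≡ i))

SignEquivalent : ∀ {m n} → SignPattern m n → SignPattern m n → Set
SignEquivalent {m} {n} S S' =
  Σ (Matrix m m) λ P₁ → Σ (Matrix n n) λ P₂ →
    IsSignedPerm P₁ × IsSignedPerm P₂ × (∀ i j → C S i j ≡ (P₁ ⊗ (C S' ⊗ P₂)) i j)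

countRow : ∀ {n} → (Fin n → Sign) → ℕ
countRow {ℕ.zero} r = 0
countRow {suc n} r = neg (r Fin.zero) Data.Nat.+ countRow (λ j → r (Fin.suc j))
  where
  neg : Sign → ℕ
  neg minus = 1
  neg _ = 0

numNeg : ∀ {m n} → SignPattern m n → ℕ
numNeg {ℕ.zero} S = 0
numNeg {suc m} S = countRow (S Fin.zero) Data.Nat.+ numNeg (λ i → S (Fin.suc i))

-- Write a nowhere-zero pattern as a 0/1 matrix b (1 marking a negative entry).
-- Negating rows and columns, i.e. multiplying by signed diagonal matrices, is a
-- sign equivalence. Negating the columns in the support of a centre row c turns
-- every row r into r ⊕ c; negating afterwards each row with at least three
-- negatives leaves a row of length 4 with at most 2 negatives, at most 1 if its
-- parity differs from that of c, and none if it equals c. So the total is at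
-- most 5 plus the size of c's parity class, minus 2 when c is one of the rows.
-- Take c to be a row from a parity class of size at most 2, or, when one
-- parity does not occur among the rows, any row of that parity.

module Submission where

open import Defs
open import Data.Nat using (_≤_)
open import Data.Product using (Σ; _×_)

open import Algebra.Bundles using (CommutativeRing)
import Algebra.Properties.CommutativeSemigroup as CommSemigroupProperties
open import Data.Bool using (Bool; true; false; _xor_; if_then_else_)
open import Data.Bool.Properties using (xor-same; xor-identityʳ; xor-∧-commutativeRing; _≟_)
open import Data.Empty using (⊥-elim)
open import Data.Fin using (Fin; zero; suc)
open import Data.Fin.Properties using (any?)
open import Data.Integer as ℤ using (ℤ; 0ℤ; 1ℤ; -1ℤ)
import Data.Integer.Properties as ℤ
open import Data.Nat as ℕ using (ℕ; _+_; _*_; _<ᵇ_; z≤n; s≤s)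
open import Data.Nat.Properties as ℕ using (≤ᵇ⇒≤; ≤-trans; ≤-total; +-mono-≤; +-assoc)
open import Data.Product using (_,_; ∃; proj₁; proj₂)
open import Data.Sum using (_⊎_; inj₁; inj₂)
open import Data.Vec.Functional using (foldr; _∷_; [])
open import Function using (_∘_)
open import Relation.Binary.PropositionalEquality
open import Relation.Nullary using (yes; no)

open CommSemigroupProperties ℕ.+-commutativeSemigroup using () renaming (interchange to +-interchange; x∙yz≈y∙xz to +-left-comm)
open CommSemigroupProperties (CommutativeRing.+-commutativeSemigroup xor-∧-commutativeRing)
  using () renaming (interchange to xor-interchange)

private
  variable
    m n l : ℕ

toSign : Bool → Sign
toSign false = plus
toSign true  = minus

isMinus : Sign → Bool
isMinus minus = true
isMinus _     = false

toSign-isMinus : ∀ s → s ≢ zer → toSign (isMinus s) ≡ s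
toSign-isMinus plus  _   = refl
toSign-isMinus minus _   = refl
toSign-isMinus zer   s≢0 = ⊥-elim (s≢0 refl)

sgn : Bool → ℤ
sgn false = 1ℤ
sgn true  = -1ℤ

signVal-toSign-xor : ∀ x y z →
  signVal (toSign z) ≡ sgn x ℤ.* (signVal (toSign (x xor (y xor z))) ℤ.* sgn y)
signVal-toSign-xor true  true  true  = refl
signVal-toSign-xor true  true  false = refl
signVal-toSign-xor true  false true  = refl
signVal-toSign-xor true  false false = refl
signVal-toSign-xor false true  true  = refl
signVal-toSign-xor false true  false = refl
signVal-toSign-xor false false true  = refl
signVal-toSign-xor false false false = refl

diag : (Fin n → Bool) → Matrix n n
diag v zero    zero    = sgn (v zero)
diag v zero    (suc k) = 0ℤ
diag v (suc i) zero    = 0ℤ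
diag v (suc i) (suc k) = diag (v ∘ suc) i k

sgn≢0 : ∀ x → sgn x ≢ 0ℤ
sgn≢0 true  ()
sgn≢0 false ()

diag-isSignEntry : (v : Fin n → Bool) → ∀ i k → IsSignEntry (diag v i k)
diag-isSignEntry v zero    zero    with v zero
... | true  = inj₁ (inj₂ refl)
... | false = inj₁ (inj₁ refl)
diag-isSignEntry v zero    (suc k) = inj₂ refl
diag-isSignEntry v (suc i) zero    = inj₂ refl
diag-isSignEntry v (suc i) (suc k) = diag-isSignEntry (v ∘ suc) i k

diag-diagonal≢0 : (v : Fin n → Bool) → ∀ i → diag v i i ≢ 0ℤ
diag-diagonal≢0 v zero    = sgn≢0 (v zero)
diag-diagonal≢0 v (suc i) = diag-diagonal≢0 (v ∘ suc) i

diag-≢0⇒≡ : (v : Fin n → Bool) → ∀ i k → diag v i k ≢ 0ℤ → i ≡ k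
diag-≢0⇒≡ v zero    zero    _  = refl
diag-≢0⇒≡ v zero    (suc k) ≢0 = ⊥-elim (≢0 refl)
diag-≢0⇒≡ v (suc i) zero    ≢0 = ⊥-elim (≢0 refl)
diag-≢0⇒≡ v (suc i) (suc k) ≢0 = cong suc (diag-≢0⇒≡ (v ∘ suc) i k ≢0)

diag-isSignedPerm : (v : Fin n → Bool) → IsSignedPerm (diag v)
diag-isSignedPerm v =
    diag-isSignEntry v
  , (λ i → i , diag-diagonal≢0 v i , λ k ≢0 → sym (diag-≢0⇒≡ v i k ≢0))
  , (λ j → j , diag-diagonal≢0 v j , λ k ≢0 → diag-≢0⇒≡ v k j ≢0)

Σ[<]-zero : (f : Fin n → ℤ) → (∀ k → f k ≡ 0ℤ) → Σ[<] f ≡ 0ℤ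
Σ[<]-zero {ℕ.zero}  f f≡0 = refl
Σ[<]-zero {ℕ.suc n} f f≡0 =
  cong₂ ℤ._+_ (f≡0 zero) (Σ[<]-zero (f ∘ suc) (f≡0 ∘ suc))

diag-⊗ : (v : Fin n → Bool) (A : Matrix n l) → ∀ i j → (diag v ⊗ A) i j ≡ sgn (v i) ℤ.* A i j
diag-⊗ v A zero j = begin
  sgn (v zero) ℤ.* A zero j ℤ.+ Σ[<] (λ k → 0ℤ ℤ.* A (suc k) j)
    ≡⟨ cong (λ t → sgn (v zero) ℤ.* A zero j ℤ.+ t) (Σ[<]-zero (λ k → 0ℤ ℤ.* A (suc k) j) (λ _ → refl)) ⟩
  sgn (v zero) ℤ.* A zero j ℤ.+ 0ℤ
    ≡⟨ ℤ.+-identityʳ _ ⟩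
  sgn (v zero) ℤ.* A zero j ∎
  where open ≡-Reasoning
diag-⊗ v A (suc i) j = trans (ℤ.+-identityˡ _) (diag-⊗ (v ∘ suc) (A ∘ suc) i j)

⊗-diag : (A : Matrix m n) (v : Fin n → Bool) → ∀ i j → (A ⊗ diag v) i j ≡ A i j ℤ.* sgn (v j)
⊗-diag A v i zero = begin
  A i zero ℤ.* sgn (v zero) ℤ.+ Σ[<] (λ k → A i (suc k) ℤ.* 0ℤ)
    ≡⟨ cong (λ t → A i zero ℤ.* sgn (v zero) ℤ.+ t) (Σ[<]-zero _ (λ k → ℤ.*-zeroʳ (A i (suc k)))) ⟩
  A i zero ℤ.* sgn (v zero) ℤ.+ 0ℤ
    ≡⟨ ℤ.+-identityʳ _ ⟩
  A i zero ℤ.* sgn (v zero) ∎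
  where open ≡-Reasoning
⊗-diag A v i (suc j) = begin
  A i zero ℤ.* 0ℤ ℤ.+ (A' ⊗ diag (v ∘ suc)) i j ≡⟨ cong₂ ℤ._+_ (ℤ.*-zeroʳ (A i zero)) refl ⟩
  0ℤ ℤ.+ (A' ⊗ diag (v ∘ suc)) i j             ≡⟨ ℤ.+-identityˡ _ ⟩
  (A' ⊗ diag (v ∘ suc)) i j                     ≡⟨ ⊗-diag A' (v ∘ suc) i j ⟩
  A i (suc j) ℤ.* sgn (v (suc j))               ∎
  where
  open ≡-Reasoning
  A' : Matrix _ _
  A' i k = A i (suc k)

flipSigns : (Fin m → Bool) → (Fin n → Bool) → (Fin m → Fin n → Bool) → SignPattern m n
flipSigns ρ c b i j = toSign (ρ i xor (c j xor b i j))

signEquivalent-flipSigns : (S : SignPattern m n) → NowhereZero S →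
  ∀ ρ c → SignEquivalent S (flipSigns ρ c (λ i j → isMinus (S i j)))
signEquivalent-flipSigns S nz ρ c =
  diag ρ , diag c , diag-isSignedPerm ρ , diag-isSignedPerm c , entries
  where
  S' : SignPattern _ _
  S' = flipSigns ρ c (λ i j → isMinus (S i j))
  entries : ∀ i j → C S i j ≡ (diag ρ ⊗ (C S' ⊗ diag c)) i j
  entries i j = begin
    signVal (S i j)                                  ≡⟨ cong signVal (toSign-isMinus (S i j) (nz i j)) ⟨
    signVal (toSign (isMinus (S i j)))               ≡⟨ signVal-toSign-xor (ρ i) (c j) (isMinus (S i j)) ⟩
    sgn (ρ i) ℤ.* (C S' i j ℤ.* sgn (c j))           ≡⟨ cong (sgn (ρ i) ℤ.*_) (⊗-diag (C S') c i j) ⟨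
    sgn (ρ i) ℤ.* (C S' ⊗ diag c) i j                ≡⟨ diag-⊗ ρ (C S' ⊗ diag c) i j ⟨
    (diag ρ ⊗ (C S' ⊗ diag c)) i j                   ∎
    where open ≡-Reasoning

_⊕_ : (Fin n → Bool) → (Fin n → Bool) → Fin n → Bool
(u ⊕ v) j = u j xor v j

weight : (Fin n → Bool) → ℕ
weight v = countRow (λ j → toSign (v j))

countRow-cong : {r s : Fin n → Sign} → (∀ j → r j ≡ s j) → countRow r ≡ countRow s
countRow-cong {ℕ.zero}  _   = refl
countRow-cong {ℕ.suc n} r≗s rewrite r≗s zero = cong₂ _+_ refl (countRow-cong (r≗s ∘ suc))

weight-cong : {u v : Fin n → Bool} → (∀ j → u j ≡ v j) → weight u ≡ weight v
weight-cong u≗v = countRow-cong (cong toSign ∘ u≗v)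

weight-false : weight (λ (_ : Fin n) → false) ≡ 0
weight-false {ℕ.zero}  = refl
weight-false {ℕ.suc n} = weight-false {n}

isHeavy : (Fin n → Bool) → Bool
isHeavy {n} v = n <ᵇ 2 * weight v

balance : (Fin n → Bool) → Fin n → Bool
balance v j = isHeavy v xor v j

balance-cong : {u v : Fin n → Bool} → (∀ j → u j ≡ v j) → ∀ j → balance u j ≡ balance v j
balance-cong u≗v j = cong₂ _xor_ (cong (λ w → _ <ᵇ 2 * w) (weight-cong u≗v)) (u≗v j)

weight-balance-false : weight (balance (λ (_ : Fin n) → false)) ≡ 0
weight-balance-false {n} rewrite weight-false {n} = weight-false {n}

weight-balance-⊕-self : (r : Fin n → Bool) → weight (balance (r ⊕ r)) ≡ 0
weight-balance-⊕-self {n} r =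
  trans (weight-cong (balance-cong (xor-same ∘ r))) (weight-balance-false {n})

parity : (Fin n → Bool) → Bool
parity = foldr _xor_ false

parity-⊕ : (u v : Fin n → Bool) → parity (u ⊕ v) ≡ parity u xor parity v
parity-⊕ {ℕ.zero}  u v = refl
parity-⊕ {ℕ.suc n} u v =
  trans (cong ((u zero xor v zero) xor_) (parity-⊕ (u ∘ suc) (v ∘ suc)))
        (xor-interchange (u zero) (v zero) (parity (u ∘ suc)) (parity (v ∘ suc)))

sameParity : Bool → Bool → ℕ
sameParity q r = if q xor r then 0 else 1

weight-balance≤ : (v : Fin 4 → Bool) → weight (balance v) ≤ 1 + (if parity v then 0 else 1)
weight-balance≤ v = bound (v zero) (v (suc zero)) (v (suc (suc zero))) (v (suc (suc (suc zero))))
  where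
  bound : ∀ a b c d → let v = a ∷ b ∷ c ∷ d ∷ [] in
          weight (balance v) ≤ 1 + (if parity v then 0 else 1)
  bound false false false false = ≤ᵇ⇒≤ _ _ _
  bound false false false true  = ≤ᵇ⇒≤ _ _ _
  bound false false true  false = ≤ᵇ⇒≤ _ _ _
  bound false false true  true  = ≤ᵇ⇒≤ _ _ _
  bound false true  false false = ≤ᵇ⇒≤ _ _ _
  bound false true  false true  = ≤ᵇ⇒≤ _ _ _
  bound false true  true  false = ≤ᵇ⇒≤ _ _ _
  bound false true  true  true  = ≤ᵇ⇒≤ _ _ _
  bound true  false false false = ≤ᵇ⇒≤ _ _ _
  bound true  false false true  = ≤ᵇ⇒≤ _ _ _
  bound true  false true  false = ≤ᵇ⇒≤ _ _ _
  bound true  false true  true  = ≤ᵇ⇒≤ _ _ _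
  bound true  true  false false = ≤ᵇ⇒≤ _ _ _
  bound true  true  false true  = ≤ᵇ⇒≤ _ _ _
  bound true  true  true  false = ≤ᵇ⇒≤ _ _ _
  bound true  true  true  true  = ≤ᵇ⇒≤ _ _ _

weight-balance-⊕≤ : (c r : Fin 4 → Bool) → weight (balance (c ⊕ r)) ≤ 1 + (sameParity (parity c) (parity r))
weight-balance-⊕≤ c r =
  subst (λ x → weight (balance (c ⊕ r)) ≤ 1 + (if x then 0 else 1)) (parity-⊕ c r) (weight-balance≤ (c ⊕ r))

sum : (Fin m → ℕ) → ℕ
sum = foldr _+_ 0

numNeg≡sum : (S : SignPattern m n) → numNeg S ≡ sum (λ i → countRow (S i))
numNeg≡sum {ℕ.zero}  S = refl
numNeg≡sum {ℕ.suc m} S = cong (countRow (S zero) +_) (numNeg≡sum (S ∘ suc))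

sum-mono-≤ : {f g : Fin m → ℕ} → (∀ i → f i ≤ g i) → sum f ≤ sum g
sum-mono-≤ {ℕ.zero}  f≤g = z≤n
sum-mono-≤ {ℕ.suc m} f≤g = +-mono-≤ (f≤g zero) (sum-mono-≤ (f≤g ∘ suc))

sum-mono-≤-gapAt : ∀ {f g : Fin m → ℕ} {d} k → (∀ i → f i ≤ g i) → f k + d ≤ g k → sum f + d ≤ sum g
sum-mono-≤-gapAt {f = f} {g} {d} zero f≤g gap = begin
  f zero + sum (f ∘ suc) + d   ≡⟨ +-assoc (f zero) _ d ⟩
  f zero + (sum (f ∘ suc) + d) ≡⟨ cong (f zero +_) (ℕ.+-comm _ d) ⟩
  f zero + (d + sum (f ∘ suc)) ≡⟨ +-assoc (f zero) d _ ⟨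
  f zero + d + sum (f ∘ suc)   ≤⟨ +-mono-≤ gap (sum-mono-≤ (f≤g ∘ suc)) ⟩
  g zero + sum (g ∘ suc)       ∎
  where open ℕ.≤-Reasoning
sum-mono-≤-gapAt {f = f} {d = d} (suc k) f≤g gap = begin
  f zero + sum (f ∘ suc) + d   ≡⟨ +-assoc (f zero) _ d ⟩
  f zero + (sum (f ∘ suc) + d) ≤⟨ +-mono-≤ (f≤g zero) (sum-mono-≤-gapAt k (f≤g ∘ suc) gap) ⟩
  _                            ∎
  where open ℕ.≤-Reasoning

sum-suc : (f : Fin m → ℕ) → sum (λ i → 1 + f i) ≡ m + sum f
sum-suc {ℕ.zero}  f = refl
sum-suc {ℕ.suc m} f = cong ℕ.suc (trans (cong (f zero +_) (sum-suc (f ∘ suc))) (+-left-comm (f zero) m _))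

classSize : Bool → (Fin m → Bool) → ℕ
classSize q p = sum (λ i → sameParity q (p i))

classSize-complement : (p : Fin m → Bool) → classSize true p + classSize false p ≡ m
classSize-complement {ℕ.zero}  p = refl
classSize-complement {ℕ.suc m} p =
  trans (+-interchange (sameParity true (p zero)) (classSize true (p ∘ suc))
                       (sameParity false (p zero)) (classSize false (p ∘ suc)))
        (cong₂ _+_ (oneClass (p zero)) (classSize-complement (p ∘ suc)))
  where
  oneClass : ∀ r → sameParity true r + sameParity false r ≡ 1
  oneClass true  = refl
  oneClass false = refl

classSize-empty : ∀ q (p : Fin m → Bool) → (∀ i → p i ≢ q) → classSize q p ≡ 0
classSize-empty {ℕ.zero}  q p p≢q = refl
classSize-empty {ℕ.suc m} q p p≢q =
  cong₂ _+_ (otherClass q (p zero) (p≢q zero)) (classSize-empty q (p ∘ suc) (p≢q ∘ suc))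
  where
  otherClass : ∀ q r → r ≢ q → sameParity q r ≡ 0
  otherClass true  true  r≢q = ⊥-elim (r≢q refl)
  otherClass true  false _   = refl
  otherClass false true  _   = refl
  otherClass false false r≢q = ⊥-elim (r≢q refl)

m+n≡o⇒2m≤o⊎2n≤o : ∀ {m n o} → m + n ≡ o → 2 * m ≤ o ⊎ 2 * n ≤ o
m+n≡o⇒2m≤o⊎2n≤o {m} {n} refl with ≤-total m n
... | inj₁ m≤n = inj₁ (ℕ.+-monoʳ-≤ m (≤-trans (ℕ.≤-reflexive (ℕ.+-identityʳ m)) m≤n))
... | inj₂ n≤m = inj₂ (subst (2 * n ≤_) (ℕ.+-comm n m) (ℕ.+-monoʳ-≤ n (≤-trans (ℕ.≤-reflexive (ℕ.+-identityʳ n)) n≤m)))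

minorityClass : (p : Fin m → Bool) → ∃ λ q → 2 * classSize q p ≤ m
minorityClass p with m+n≡o⇒2m≤o⊎2n≤o {classSize true p} {classSize false p} (classSize-complement p)
... | inj₁ small = true  , small
... | inj₂ small = false , small

smallOrEmptyClass : (p : Fin m → Bool) →
  (∃ λ q → classSize q p ≡ 0) ⊎ (∃ λ k → 2 * classSize (p k) p ≤ m)
smallOrEmptyClass p with minorityClass p
... | q , small with any? (λ i → p i ≟ q)
...   | yes (k , refl) = inj₂ (k , small)
...   | no  none       = inj₁ (q , classSize-empty q p (λ i pi≡q → none (i , pi≡q)))

balancedAround : (Fin 4 → Bool) → (Fin m → Fin 4 → Bool) → SignPattern m 4
balancedAround c b = flipSigns (λ i → isHeavy (c ⊕ b i)) c b

numNeg-balancedAround : (c : Fin 4 → Bool) (b : Fin m → Fin 4 → Bool) →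
  numNeg (balancedAround c b) ≡ sum (λ i → weight (balance (c ⊕ b i)))
numNeg-balancedAround c b = numNeg≡sum (balancedAround c b)

numNeg-balancedAround≤ : (c : Fin 4 → Bool) (b : Fin m → Fin 4 → Bool) →
  numNeg (balancedAround c b) ≤ m + classSize (parity c) (parity ∘ b)
numNeg-balancedAround≤ {m} c b = begin
  numNeg (balancedAround c b)                              ≡⟨ numNeg-balancedAround c b ⟩
  sum (λ i → weight (balance (c ⊕ b i)))                  ≤⟨ sum-mono-≤ (λ i → weight-balance-⊕≤ c (b i)) ⟩
  sum (λ i → 1 + sameParity (parity c) (parity (b i)))    ≡⟨ sum-suc (λ i → sameParity (parity c) (parity (b i))) ⟩
  m + classSize (parity c) (parity ∘ b)                   ∎
  where open ℕ.≤-Reasoning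

numNeg-balancedAroundRow≤ : (b : Fin m → Fin 4 → Bool) (k : Fin m) →
  numNeg (balancedAround (b k) b) + 2 ≤ m + classSize (parity (b k)) (parity ∘ b)
numNeg-balancedAroundRow≤ {m} b k = begin
  numNeg (balancedAround (b k) b) + 2                      ≡⟨ cong (_+ 2) (numNeg-balancedAround (b k) b) ⟩
  sum (λ i → weight (balance (b k ⊕ b i))) + 2            ≤⟨ sum-mono-≤-gapAt k (λ i → weight-balance-⊕≤ (b k) (b i)) centreRow ⟩
  sum (λ i → 1 + sameParity (parity (b k)) (parity (b i))) ≡⟨ sum-suc (λ i → sameParity (parity (b k)) (parity (b i))) ⟩
  m + classSize (parity (b k)) (parity ∘ b)                ∎
  where
  open ℕ.≤-Reasoning
  centreRow : weight (balance (b k ⊕ b k)) + 2 ≤ 1 + sameParity (parity (b k)) (parity (b k))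
  centreRow = ℕ.≤-reflexive (trans (cong (_+ 2) (weight-balance-⊕-self (b k)))
                                   (sym (cong (λ x → 1 + (if x then 0 else 1)) (xor-same (parity (b k))))))

rowOfParity : Bool → Fin 4 → Bool
rowOfParity q = q ∷ false ∷ false ∷ false ∷ []

parity-rowOfParity : ∀ q → parity (rowOfParity q) ≡ q
parity-rowOfParity = xor-identityʳ

balancedAround≤5 : (b : Fin 5 → Fin 4 → Bool) → ∃ λ c → numNeg (balancedAround c b) ≤ 5
balancedAround≤5 b with smallOrEmptyClass (parity ∘ b)
... | inj₁ (q , empty) = rowOfParity q , freshCentre≤5
  where
  open ℕ.≤-Reasoning
  freshCentre≤5 : numNeg (balancedAround (rowOfParity q) b) ≤ 5
  freshCentre≤5 = begin
    numNeg (balancedAround (rowOfParity q) b)             ≤⟨ numNeg-balancedAround≤ (rowOfParity q) b ⟩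
    5 + classSize (parity (rowOfParity q)) (parity ∘ b)  ≡⟨ cong (λ x → 5 + classSize x (parity ∘ b)) (parity-rowOfParity q) ⟩
    5 + classSize q (parity ∘ b)                         ≡⟨ cong (5 +_) empty ⟩
    5                                                    ∎
... | inj₂ (k , small) = b k , ℕ.+-cancelʳ-≤ 2 _ 5 rowCentre+2≤7
  where
  atMostTwo : classSize (parity (b k)) (parity ∘ b) ≤ 2
  atMostTwo = ℕ.≤-pred (ℕ.*-cancelˡ-< 2 _ 3 (s≤s small))
  rowCentre+2≤7 : numNeg (balancedAround (b k) b) + 2 ≤ 5 + 2
  rowCentre+2≤7 = ≤-trans (numNeg-balancedAroundRow≤ b k) (ℕ.+-monoʳ-≤ 5 atMostTwo)

lemma3p24 : (S : SignPattern 5 4) → NowhereZero S →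
    Σ (SignPattern 5 4) λ S' → SignEquivalent S S' × numNeg S' ≤ 5
lemma3p24 S nz = balancedAround c b , signEquivalent-flipSigns S nz (λ i → isHeavy (c ⊕ b i)) c , numNeg≤5
  where
  b : Fin 5 → Fin 4 → Bool
  b i j = isMinus (S i j)
  c : Fin 4 → Bool
  c = proj₁ (balancedAround≤5 b)
  numNeg≤5 : numNeg (balancedAround c b) ≤ 5
  numNeg≤5 = proj₂ (balancedAround≤5 b)
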